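{- Let $\pi_1,\dots,\pi_k$ be pairwise disjoint nonempty subsets of $[n]$ such that the partition $\pi_{\min}$ of $[n]$ consisting of $\pi_1,\dots,\pi_k$ together with the singletons $\{x\}$, $x\notin\bigcup_i\pi_i$, is noncrossing. Write $\pi_i=\{x^i_1<\cdots<x^i_{|\pi_i|}\}$. Let $\mathcal{NCP}_\pi(n)$ be the set of $\mu\in\mathcal{NCP}(n)$ such that each $\pi_i$ is a block of $\mu$. Define $$\mu_0=\{x\in[n]: x\notin\textstyle\bigcup_i\pi_i \text{ and } \{x\}\not\prec\pi_j \text{ for all } j\},$$ and for $1\le i\le k$, $1\le j\le|\pi_i|-1$, $$\mu_i^j=\{l: x^i_j<l<x^i_{j+1},\ l\notin\textstyle\bigcup_{i'}\pi_{i'},\ \text{and } \{l\}\not\prec\pi_{j'} \text{ for every } j' \text{ with } \pi_{j'}\prec\pi_i\},$$ where $\prec$ is the nesting order on blocks of $\pi_{\min}$. Then $\mathcal{NCP}_\pi(n)$ is a sublattice of $\mathcal{NCP}(n)$, and it is isomorphic as a lattice to the cartesian product of the lattices $\mathcal{NCP}(\mu_0)$ and $\mathcal{NCP}(\mu_i^j)$, $1\le i\le k$, $1\le j\le|\pi_i|-1$.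
   Context: A partition of a finite totally ordered set $S$ is noncrossing if there are no two distinct blocks $B,C$ and $a<b<c<d$ in $S$ with $a,c\in B$, $b,d\in C$. $\mathcal{NCP}(S)$ is the lattice of noncrossing partitions of $S$ under refinement (each block of the finer partition contained in a block of the coarser); $\mathcal{NCP}(n):=\mathcal{NCP}([n])$ with $[n]=\{1,\dots,n\}$ (for $S$ empty, $\mathcal{NCP}(S)$ is the one-element lattice). The nesting order on the blocks of a noncrossing partition is: $B\prec C$ iff $\inf C<\inf B\le\sup B<\sup C$. -}

module Defs where

open import Data.Nat using (ℕ; _<_; _≤_)
open import Data.Fin using (Fin; inject₁; suc)
open import Data.List using (List; lookup; length)
open import Data.List.NonEmpty using (List⁺; [_]; head; last; toList; tail)
open import Data.List.Membership.Propositional using (_∈_; _∉_)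
open import Data.Product using (Σ; _×_; _,_; ∃)
open import Data.Sum using (_⊎_)
open import Relation.Binary.PropositionalEquality using (_≡_)
open import Relation.Nullary using (¬_)
open import Function.Bundles using (_⇔_)

InN : ℕ → ℕ → Set
InN n x = 1 ≤ x × x ≤ n

-- A partition of a subset S ⊆ ℕ (totally ordered by the order of ℕ),
-- given by its "same block" equivalence relation, supported on S.
record Partition (S : ℕ → Set) : Set₁ where
  field
    _~_     : ℕ → ℕ → Set
    support : ∀ {x y} → x ~ y → S x × S y
    ~-refl  : ∀ {x} → S x → x ~ x
    ~-sym   : ∀ {x y} → x ~ y → y ~ x
    ~-trans : ∀ {x y z} → x ~ y → y ~ z → x ~ z

-- Noncrossing: no a<b<c<d with a,c in one block and b,d in a different one
-- (i.e. if a~c and b~d then a and b lie in the same block).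
NonCrossingRel : (ℕ → ℕ → Set) → Set
NonCrossingRel R = ∀ {a b c d} → a < b → b < c → c < d → R a c → R b d → R a b

NCP : (ℕ → Set) → Set₁
NCP S = Σ (Partition S) (λ P → NonCrossingRel (Partition._~_ P))

rel : ∀ {S} → NCP S → ℕ → ℕ → Set
rel (P , _) = Partition._~_ P

_≤P_ : ∀ {S} → NCP S → NCP S → Set
μ ≤P ν = ∀ {x y} → rel μ x y → rel ν x y

_≈P_ : ∀ {S} → NCP S → NCP S → Set
μ ≈P ν = μ ≤P ν × ν ≤P μ

IsMeet : ∀ {S} → NCP S → NCP S → NCP S → Set₁
IsMeet {S} μ ν ρ = ρ ≤P μ × ρ ≤P ν × (∀ (σ : NCP S) → σ ≤P μ → σ ≤P ν → σ ≤P ρ)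

IsJoin : ∀ {S} → NCP S → NCP S → NCP S → Set₁
IsJoin {S} μ ν ρ = μ ≤P ρ × ν ≤P ρ × (∀ (σ : NCP S) → μ ≤P σ → ν ≤P σ → ρ ≤P σ)

_≺_ : List⁺ ℕ → List⁺ ℕ → Set
B ≺ C = head C < head B × head B ≤ last B × last B < last C

πmin : (n k : ℕ) → (Fin k → List⁺ ℕ) → ℕ → ℕ → Set
πmin n k π x y = (x ≡ y × InN n x × (∀ i → x ∉ toList (π i)))
               ⊎ Σ (Fin k) (λ i → x ∈ toList (π i) × y ∈ toList (π i))

HasBlocks : ∀ {n} (k : ℕ) → (Fin k → List⁺ ℕ) → NCP (InN n) → Set
HasBlocks k π μ = ∀ i x y → x ∈ toList (π i) → (rel μ x y ⇔ y ∈ toList (π i))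

NCPπ : (n k : ℕ) → (Fin k → List⁺ ℕ) → Set₁
NCPπ n k π = Σ (NCP (InN n)) (HasBlocks k π)

μ₀ : (n k : ℕ) → (Fin k → List⁺ ℕ) → ℕ → Set
μ₀ n k π x = InN n x × (∀ i → x ∉ toList (π i)) × (∀ j → ¬ ([ x ] ≺ π j))

-- index set {(i,j) : 1 ≤ i ≤ k, 1 ≤ j ≤ |π_i| - 1}
Gap : (k : ℕ) → (Fin k → List⁺ ℕ) → Set
Gap k π = Σ (Fin k) (λ i → Fin (length (tail (π i))))

-- μ_i^j ; x^i_j = lookup (toList (π i)) (inject₁ j), x^i_{j+1} = lookup (toList (π i)) (suc j)
μgap : (k : ℕ) → (π : Fin k → List⁺ ℕ) → Gap k π → ℕ → Set
μgap k π (i , j) l =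
  lookup (toList (π i)) (inject₁ j) < l × l < lookup (toList (π i)) (suc j)
  × (∀ i' → l ∉ toList (π i'))
  × (∀ j' → π j' ≺ π i → ¬ ([ l ] ≺ π j'))

Prod : (n k : ℕ) → (Fin k → List⁺ ℕ) → Set₁
Prod n k π = NCP (μ₀ n k π) × ((g : Gap k π) → NCP (μgap k π g))

_≤Prod_ : ∀ {n k π} → Prod n k π → Prod n k π → Set
_≤Prod_ {k = k} {π} (a , f) (b , g) = a ≤P b × (∀ (x : Gap k π) → f x ≤P g x)

_≈Prod_ : ∀ {n k π} → Prod n k π → Prod n k π → Set
p ≈Prod q = p ≤Prod q × q ≤Prod p

IsSublattice : (n k : ℕ) → (Fin k → List⁺ ℕ) → Set₁
IsSublattice n k π =
  (∀ (μ ν ρ : NCP (InN n)) → HasBlocks k π μ → HasBlocks k π ν → IsMeet μ ν ρ → HasBlocks k π ρ)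
  × (∀ (μ ν ρ : NCP (InN n)) → HasBlocks k π μ → HasBlocks k π ν → IsJoin μ ν ρ → HasBlocks k π ρ)

-- lattice isomorphism NCP_π(n) ≅ Prod, as an order isomorphism
-- (order-embedding that is surjective up to equality in the product)
LatticeIso : (n k : ℕ) → (π : Fin k → List⁺ ℕ) → Set₁
LatticeIso n k π =
  Σ (NCPπ n k π → Prod n k π) λ φ →
    (∀ (a b : NCPπ n k π) → (Σ.proj₁ a ≤P Σ.proj₁ b ⇔ φ a ≤Prod φ b))
    × (∀ (p : Prod n k π) → Σ (NCPπ n k π) (λ a → φ a ≈Prod p))

{-# OPTIONS --safe #-}
module Submission where

-- A block xs = {x₁ < ⋯ < x_m} of a noncrossing partition splits the remaining points into the
-- gaps (x_j , x_{j+1}) and the outer region below x₁ or above x_m, and every other block stays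
-- inside one of these. So the noncrossing partitions having xs as a block lie between the
-- finest one (xs and singletons) and the coarsest one (xs and the gaps); comparing a meet with
-- the former and a join with the latter shows both keep xs as a block. For the isomorphism,
-- a point outside all πᵢ is sent to the gap of the innermost πᵢ nesting it, or to μ₀ if there
-- is none. This region is determined by the gap indices of the point with respect to all πᵢ,
-- which are constant on the blocks of every μ ∈ NCP_π(n); hence μ is the union of the πᵢ and
-- of its restrictions to the regions. Conversely, partitions of the regions glue, together
-- with the πᵢ, to a noncrossing partition, because the gap indices separate the regions.

open import Data.Nat using (ℕ; suc; _<_; _≤_; z≤n; s≤s; _<?_; _≤?_; _≟_)
open import Data.Nat.Properties
open import Data.Empty using (⊥)
open import Data.Fin as F using (Fin; toℕ; inject₁)
open import Data.Fin.Properties using (toℕ-inject₁; toℕ-fromℕ<; toℕ<n; toℕ-injective; any?)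
open import Data.List using (List; []; _∷_; length; lookup; filter; allFin)
open import Data.List.Extrema ≤-totalOrder using (argmax; argmax-all; f[xs]≤f[argmax])
open import Data.List.Membership.DecPropositional _≟_ using (_∈?_)
open import Data.List.Membership.Propositional using (_∈_; _∉_)
open import Data.List.Membership.Propositional.Properties using (∈-lookup; ∈-++⁺ʳ; ∈-filter⁺; ∈-allFin)
open import Data.List.NonEmpty using (List⁺; [_]; toList; head; last; snocView; _∷ʳ′_; _∷ʳ_)
open import Data.List.Relation.Unary.All as All using ()
open import Data.List.Relation.Unary.All.Properties using (all-filter)
open import Data.List.Relation.Unary.Any using (here; there)
open import Data.List.Relation.Unary.Linked as Linked using (Linked; _∷_)
open import Data.Maybe using (Maybe; nothing; just)
open import Data.Product using (∃; _×_; _,_; proj₁; proj₂)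
open import Data.Sum using (_⊎_; inj₁; inj₂; [_,_]′)
open import Defs
open import Function using (_∘_; _∘₂_; case_of_)
open import Function.Bundles using (_⇔_; mk⇔; module Equivalence)
open import Relation.Binary.Definitions using (tri<; tri≈; tri>)
open import Relation.Binary.PropositionalEquality hiding ([_]; isEquivalence)
open import Relation.Binary.Structures using (IsEquivalence)
open import Relation.Nullary using (¬_; Dec; yes; no; contradiction)
open import Relation.Nullary.Decidable using (_×-dec_; decidable-stable)
open import Relation.Unary using (Decidable)

countBelow : List ℕ → ℕ → ℕ
countBelow []       l = 0
countBelow (x ∷ xs) l with x <? l
... | yes _ = suc (countBelow xs l)
... | no  _ = countBelow xs l

countBelow≤length : ∀ xs l → countBelow xs l ≤ length xs
countBelow≤length []       l = z≤n
countBelow≤length (x ∷ xs) l with x <? l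
... | yes _ = s≤s (countBelow≤length xs l)
... | no  _ = m≤n⇒m≤1+n (countBelow≤length xs l)

countBelow-mono : ∀ xs {a b} → a ≤ b → countBelow xs a ≤ countBelow xs b
countBelow-mono []       a≤b = z≤n
countBelow-mono (x ∷ xs) {a} {b} a≤b with x <? a | x <? b
... | yes _   | yes _   = s≤s (countBelow-mono xs a≤b)
... | yes x<a | no  x≮b = contradiction (<-≤-trans x<a a≤b) x≮b
... | no  _   | yes _   = m≤n⇒m≤1+n (countBelow-mono xs a≤b)
... | no  _   | no  _   = countBelow-mono xs a≤b

countBelow-strict : ∀ xs {x a b} → x ∈ xs → a ≤ x → x < b → countBelow xs a < countBelow xs b
countBelow-strict (y ∷ xs) {x} {a} {b} x∈ a≤x x<b with y <? a | y <? b
countBelow-strict (y ∷ xs) (here refl) a≤x x<b | yes y<a | _       = contradiction y<a (≤⇒≯ a≤x)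
countBelow-strict (y ∷ xs) (here refl) a≤x x<b | no  _   | yes _   = s≤s (countBelow-mono xs (≤-trans a≤x (<⇒≤ x<b)))
countBelow-strict (y ∷ xs) (here refl) a≤x x<b | no  _   | no  y≮b = contradiction x<b y≮b
countBelow-strict (y ∷ xs) (there x∈)  a≤x x<b | yes _   | yes _   = s≤s (countBelow-strict xs x∈ a≤x x<b)
countBelow-strict (y ∷ xs) (there x∈)  a≤x x<b | yes y<a | no  y≮b = contradiction (<-trans y<a (≤-<-trans a≤x x<b)) y≮b
countBelow-strict (y ∷ xs) (there x∈)  a≤x x<b | no  _   | yes _   = m<n⇒m<1+n (countBelow-strict xs x∈ a≤x x<b)
countBelow-strict (y ∷ xs) (there x∈)  a≤x x<b | no  _   | no  _   = countBelow-strict xs x∈ a≤x x<b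

countBelow<length : ∀ xs {x l} → x ∈ xs → l ≤ x → countBelow xs l < length xs
countBelow<length xs {x} x∈ l≤x =
  <-≤-trans (countBelow-strict xs x∈ l≤x (n<1+n x)) (countBelow≤length xs (suc x))

countBelow≡0 : ∀ xs {l} → (∀ {x} → x ∈ xs → l ≤ x) → countBelow xs l ≡ 0
countBelow≡0 []       _ = refl
countBelow≡0 (x ∷ xs) {l} l≤ with x <? l
... | yes x<l = contradiction x<l (≤⇒≯ (l≤ (here refl)))
... | no  _   = countBelow≡0 xs (l≤ ∘ there)

countBelow≡length : ∀ xs {l} → (∀ {x} → x ∈ xs → x < l) → countBelow xs l ≡ length xs
countBelow≡length []       _ = refl
countBelow≡length (x ∷ xs) {l} <l with x <? l
... | yes _   = cong suc (countBelow≡length xs (<l ∘ there))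
... | no  x≮l = contradiction (<l (here refl)) x≮l

countBelow-<⇒∈-between : ∀ xs {a b} → countBelow xs a < countBelow xs b →
                         ∃ λ x → x ∈ xs × a ≤ x × x < b
countBelow-<⇒∈-between (x ∷ xs) {a} {b} lt with x <? a | x <? b
... | yes _   | yes _   = let (y , y∈ , a≤y , y<b) = countBelow-<⇒∈-between xs (≤-pred lt)
                          in y , there y∈ , a≤y , y<b
... | yes x<a | no  x≮b =
  contradiction (<-trans (n<1+n _) lt) (≤⇒≯ (countBelow-mono xs (≤-trans (≮⇒≥ x≮b) (<⇒≤ x<a))))
... | no  x≮a | yes x<b = x , here refl , ≮⇒≥ x≮a , x<b
... | no  _   | no  _   = let (y , y∈ , a≤y , y<b) = countBelow-<⇒∈-between xs lt
                          in y , there y∈ , a≤y , y<b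

countBelow>0⇒∈-below : ∀ xs {l} → 0 < countBelow xs l → ∃ λ x → x ∈ xs × x < l
countBelow>0⇒∈-below xs pos
  with countBelow-<⇒∈-between xs (≤-<-trans (≤-reflexive (countBelow≡0 xs λ _ → z≤n)) pos)
... | x , x∈ , _ , x<l = x , x∈ , x<l

countBelow<length⇒∈-above : ∀ xs {l} → countBelow xs l < length xs → ∃ λ x → x ∈ xs × l ≤ x
countBelow<length⇒∈-above (x ∷ xs) {l} lt with x <? l
... | yes _ = let (y , y∈ , l≤y) = countBelow<length⇒∈-above xs (≤-pred lt) in y , there y∈ , l≤y
... | no x≮l = x , here refl , ≮⇒≥ x≮l

countBelow-constant : ∀ xs {lo hi} → (∀ {z} → z ∈ xs → lo < z → z < hi → ⊥) →
                      ∀ {a b} → lo < a → a < hi → lo < b → b < hi → countBelow xs a ≡ countBelow xs b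
countBelow-constant xs {lo} {hi} avoid {a} {b} lo<a a<hi lo<b b<hi =
  [ ordered lo<a b<hi , sym ∘ ordered lo<b a<hi ]′ (≤-total a b)
  where
  ordered : ∀ {a b} → lo < a → b < hi → a ≤ b → countBelow xs a ≡ countBelow xs b
  ordered lo<a b<hi a≤b = ≤-antisym (countBelow-mono xs a≤b) (≮⇒≥ λ lt →
    let (z , z∈ , a≤z , z<b) = countBelow-<⇒∈-between xs lt in avoid z∈ (<-≤-trans lo<a a≤z) (<-trans z<b b<hi))

-- Gap indices

wrapAt : ℕ → ℕ → ℕ
wrapAt m c with c ≟ m
... | yes _ = 0
... | no  _ = c

-- For c ≤ m, wrapAt m c is c mod m. Thus for sorted xs = x₁ < ⋯ < x_m the gap (x_j , x_{j+1})
-- has index j, while the two outer regions, below x₁ and above x_m, share the index 0.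
gapIndex : List ℕ → ℕ → ℕ
gapIndex xs l = wrapAt (length xs) (countBelow xs l)

wrapAt-self : ∀ m → wrapAt m m ≡ 0
wrapAt-self m with m ≟ m
... | yes _   = refl
... | no  m≢m = contradiction refl m≢m

wrapAt-< : ∀ {m c} → c < m → wrapAt m c ≡ c
wrapAt-< {m} {c} c<m with c ≟ m
... | yes c≡m = contradiction c≡m (<⇒≢ c<m)
... | no  _   = refl

wrapAt-zero : ∀ m → wrapAt m 0 ≡ 0
wrapAt-zero m with 0 ≟ m
... | yes _ = refl
... | no  _ = refl

wrapAt≡suc : ∀ {m c t} → wrapAt m c ≡ suc t → c ≡ suc t
wrapAt≡suc {m} {c} eq with c ≟ m
... | no _ = eq

wrapAt-≡ : ∀ {m c c'} → c ≤ c' → c' ≤ m → wrapAt m c ≡ wrapAt m c' → c ≡ c' ⊎ (c ≡ 0 × c' ≡ m)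
wrapAt-≡ {m} {c} {c'} c≤c' c'≤m eq with m≤n⇒m<n∨m≡n c'≤m
... | inj₁ c'<m = inj₁ (begin
  c           ≡⟨ wrapAt-< (≤-<-trans c≤c' c'<m) ⟨
  wrapAt m c  ≡⟨ eq ⟩
  wrapAt m c' ≡⟨ wrapAt-< c'<m ⟩
  c'          ∎)
  where open ≡-Reasoning
... | inj₂ refl with m≤n⇒m<n∨m≡n c≤c'
...   | inj₁ c<c' = inj₂ (trans (sym (wrapAt-< c<c')) (trans eq (wrapAt-self c')) , refl)
...   | inj₂ c≡c' = inj₁ c≡c'

gapIndex-≡ : ∀ xs {a b} →
             countBelow xs a ≡ countBelow xs b ⊎ (countBelow xs a ≡ 0 × countBelow xs b ≡ length xs) →
             gapIndex xs a ≡ gapIndex xs b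
gapIndex-≡ xs (inj₁ same) = cong (wrapAt _) same
gapIndex-≡ xs {a} {b} (inj₂ (a≡0 , b≡len)) = begin
  gapIndex xs a                  ≡⟨ cong (wrapAt _) a≡0 ⟩
  wrapAt (length xs) 0           ≡⟨ wrapAt-zero (length xs) ⟩
  0                              ≡⟨ wrapAt-self (length xs) ⟨
  wrapAt (length xs) (length xs) ≡⟨ cong (wrapAt _) b≡len ⟨
  gapIndex xs b                  ∎
  where open ≡-Reasoning

gapIndex-noncrossing : ∀ xs {a b c d} → a < b → b < c → c < d →
                       gapIndex xs a ≡ gapIndex xs c → gapIndex xs b ≡ gapIndex xs d →
                       gapIndex xs a ≡ gapIndex xs b
gapIndex-noncrossing xs {a} {b} {c} {d} a<b b<c c<d ac bd
  with wrapAt-≡ (countBelow-mono xs (<⇒≤ (<-trans a<b b<c))) (countBelow≤length xs c) ac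
... | inj₁ a≡c = cong (wrapAt _) (≤-antisym (countBelow-mono xs (<⇒≤ a<b))
                                     (subst (countBelow xs b ≤_) (sym a≡c) (countBelow-mono xs (<⇒≤ b<c))))
... | inj₂ (a≡0 , c≡len) = trans (gapIndex-≡ xs (inj₂ (a≡0 , d≡len))) (sym bd)
  where
  d≡len : countBelow xs d ≡ length xs
  d≡len = ≤-antisym (countBelow≤length xs d) (subst (_≤ countBelow xs d) c≡len (countBelow-mono xs (<⇒≤ c<d)))

gapIndex≢-interleavedˡ : ∀ xs {a b c d} → a < b → b < c → c < d → a ∈ xs → c ∈ xs →
                         gapIndex xs b ≢ gapIndex xs d
gapIndex≢-interleavedˡ xs a<b b<c c<d a∈ c∈ eq =
  [ <⇒≢ b<d , <⇒≢ 0<b ∘ sym ∘ proj₁ ]′ (wrapAt-≡ (<⇒≤ b<d) (countBelow≤length xs _) eq)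
  where
  0<b = ≤-<-trans z≤n (countBelow-strict xs a∈ z≤n a<b)
  b<d = countBelow-strict xs c∈ (<⇒≤ b<c) c<d

gapIndex≢-interleavedʳ : ∀ xs {a b c d} → a < b → b < c → c < d → b ∈ xs → d ∈ xs →
                         gapIndex xs a ≢ gapIndex xs c
gapIndex≢-interleavedʳ xs a<b b<c c<d b∈ d∈ eq =
  [ <⇒≢ a<c , <⇒≢ c<len ∘ proj₂ ]′ (wrapAt-≡ (<⇒≤ a<c) (<⇒≤ c<len) eq)
  where
  a<c   = countBelow-strict xs b∈ (<⇒≤ a<b) b<c
  c<len = countBelow<length xs d∈ (<⇒≤ c<d)

head≤ : ∀ {x xs y} → Linked _<_ (x ∷ xs) → y ∈ x ∷ xs → x ≤ y
head≤ _          (here refl) = ≤-refl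
head≤ (x<x' ∷ s) (there y∈)  = <⇒≤ (<-≤-trans x<x' (head≤ s y∈))

last-∈ : (xs : List⁺ ℕ) → last xs ∈ toList xs
last-∈ xs with snocView xs
... | []       ∷ʳ′ y = here refl
... | (x ∷ ys) ∷ʳ′ y = there (∈-++⁺ʳ ys (here refl))

≤last : (xs : List⁺ ℕ) → Linked _<_ (toList xs) → ∀ {y} → y ∈ toList xs → y ≤ last xs
≤last xs with snocView xs
... | ys ∷ʳ′ y = λ s → ≤-∷ʳ ys s
  where
  ≤-∷ʳ : ∀ ys {y z} → Linked _<_ (toList (ys ∷ʳ y)) → z ∈ toList (ys ∷ʳ y) → z ≤ y
  ≤-∷ʳ []            _           (here refl)         = ≤-refl
  ≤-∷ʳ (x ∷ [])      (x<y ∷ _)   (here refl)         = <⇒≤ x<y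
  ≤-∷ʳ (x ∷ [])      _           (there (here refl)) = ≤-refl
  ≤-∷ʳ (x ∷ x' ∷ xs) (x<x' ∷ s)  (here refl)         = <⇒≤ (<-≤-trans x<x' (≤-∷ʳ (x' ∷ xs) s (here refl)))
  ≤-∷ʳ (x ∷ x' ∷ xs) (_ ∷ s)     (there z∈)          = ≤-∷ʳ (x' ∷ xs) s z∈

lookup<⇔<countBelow : ∀ {ys l} → Linked _<_ ys → (p : Fin (length ys)) →
                      lookup ys p < l ⇔ toℕ p < countBelow ys l
lookup<⇔<countBelow {y ∷ ys} {l} s p with y <? l
lookup<⇔<countBelow {y ∷ ys} s F.zero    | yes y<l = mk⇔ (λ _ → s≤s z≤n) (λ _ → y<l)
lookup<⇔<countBelow {y ∷ ys} s (F.suc p) | yes _   = mk⇔ (s≤s ∘ to) (from ∘ ≤-pred)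
  where open Equivalence (lookup<⇔<countBelow (Linked.tail s) p)
lookup<⇔<countBelow {y ∷ ys} {l} s p     | no y≮l  =
  mk⇔ (λ p< → contradiction p< (≤⇒≯ (≤-trans (≮⇒≥ y≮l) (head≤ s (∈-lookup p)))))
      (λ p<c → contradiction (subst (toℕ p <_) c≡0 p<c) n≮0)
  where
  c≡0 : countBelow ys l ≡ 0
  c≡0 = countBelow≡0 ys (λ z∈ → ≤-trans (≮⇒≥ y≮l) (head≤ s (there z∈)))

between⇔countBelow≡ : ∀ {x xs l} → Linked _<_ (x ∷ xs) → l ∉ x ∷ xs → (j : Fin (length xs)) →
                      (lookup (x ∷ xs) (inject₁ j) < l × l < lookup (x ∷ xs) (F.suc j))
                      ⇔ countBelow (x ∷ xs) l ≡ suc (toℕ j)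
between⇔countBelow≡ {x} {xs} {l} s l∉ j = mk⇔ to from
  where
  module Lo = Equivalence (lookup<⇔<countBelow {l = l} s (inject₁ j))
  module Hi = Equivalence (lookup<⇔<countBelow {l = l} s (F.suc j))
  to : lookup (x ∷ xs) (inject₁ j) < l × l < lookup (x ∷ xs) (F.suc j) → countBelow (x ∷ xs) l ≡ suc (toℕ j)
  to (lo , hi) = ≤-antisym (≮⇒≥ (<-asym hi ∘ Hi.from))
                           (subst (_< countBelow (x ∷ xs) l) (toℕ-inject₁ j) (Lo.to lo))
  from : countBelow (x ∷ xs) l ≡ suc (toℕ j) → lookup (x ∷ xs) (inject₁ j) < l × l < lookup (x ∷ xs) (F.suc j)
  from c≡ = Lo.from (subst₂ _<_ (sym (toℕ-inject₁ j)) (sym c≡) ≤-refl)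
          , ≤∧≢⇒< (≮⇒≥ (<-irrefl (sym c≡) ∘ Hi.to)) (λ { refl → l∉ (∈-lookup (F.suc j)) })

-- Noncrossing partitions with a prescribed block

module _ {S : ℕ → Set} (μ : NCP S) where

  rel-support : ∀ {x y} → rel μ x y → S x × S y
  rel-support = Partition.support (proj₁ μ)

  rel-refl : ∀ {x} → S x → rel μ x x
  rel-refl = Partition.~-refl (proj₁ μ)

  rel-sym : ∀ {x y} → rel μ x y → rel μ y x
  rel-sym = Partition.~-sym (proj₁ μ)

  rel-trans : ∀ {x y z} → rel μ x y → rel μ y z → rel μ x z
  rel-trans = Partition.~-trans (proj₁ μ)

  rel-noncrossing : NonCrossingRel (rel μ)
  rel-noncrossing = proj₂ μ

inducedNCP : (S : ℕ → Set) {E : ℕ → ℕ → Set} → IsEquivalence E → NonCrossingRel E → NCP S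
inducedNCP S {E} isEquivalence noncrossing = partition , λ a<b b<c c<d (sa , _ , ac) (sb , _ , bd) →
  sa , sb , noncrossing a<b b<c c<d ac bd
  where
  module E = IsEquivalence isEquivalence
  partition : Partition S
  partition = record
    { _~_     = λ x y → S x × S y × E x y
    ; support = λ (sx , sy , _) → sx , sy
    ; ~-refl  = λ sx → sx , sx , E.refl
    ; ~-sym   = λ (sx , sy , e) → sy , sx , E.sym e
    ; ~-trans = λ (sx , _ , e) (_ , sz , e') → sx , sz , E.trans e e'
    }

restrict : ∀ {S T} → (∀ {x} → T x → S x) → NCP S → NCP T
restrict {S} {T} T⊆S μ = partition , λ a<b b<c c<d (ac , ta , _) (bd , tb , _) →
  rel-noncrossing μ a<b b<c c<d ac bd , ta , tb
  where
  partition : Partition T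
  partition = record
    { _~_     = λ x y → rel μ x y × T x × T y
    ; support = λ (_ , tx , ty) → tx , ty
    ; ~-refl  = λ tx → rel-refl μ (T⊆S tx) , tx , tx
    ; ~-sym   = λ (r , tx , ty) → rel-sym μ r , ty , tx
    ; ~-trans = λ (r , tx , _) (r' , _ , tz) → rel-trans μ r r' , tx , tz
    }

IsBlock : ∀ {S} → NCP S → List ℕ → Set
IsBlock μ xs = ∀ x y → x ∈ xs → (rel μ x y ⇔ y ∈ xs)

module _ {S : ℕ → Set} (μ : NCP S) {xs : List ℕ} (block : IsBlock μ xs) where

  block-closed : ∀ {x y} → x ∈ xs → rel μ x y → y ∈ xs
  block-closed x∈ = Equivalence.to (block _ _ x∈)

  block-related : ∀ {x y} → x ∈ xs → y ∈ xs → rel μ x y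
  block-related x∈ = Equivalence.from (block _ _ x∈)

  block⊆support : ∀ {x} → x ∈ xs → S x
  block⊆support x∈ = proj₁ (rel-support μ (block-related x∈ x∈))

  -- An element x of xs between a and b would force a below and b above all of xs, as
  -- otherwise the block xs would cross the block of a and b.
  related-outside-block : ∀ {a b} → a < b → a ∉ xs → b ∉ xs → rel μ a b →
                          countBelow xs a ≡ countBelow xs b
                          ⊎ (countBelow xs a ≡ 0 × countBelow xs b ≡ length xs)
  related-outside-block {a} {b} a<b a∉ b∉ ab with countBelow xs a ≟ countBelow xs b
  ... | yes same = inj₁ same
  ... | no differ with countBelow-<⇒∈-between xs (≤∧≢⇒< (countBelow-mono xs (<⇒≤ a<b)) differ)
  ...   | x , x∈ , a≤x , x<b =
    inj₂ (n≤0⇒n≡0 (≮⇒≥ nothing-below) , ≤-antisym (countBelow≤length xs b) (≮⇒≥ nothing-above))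
    where
    a<x : a < x
    a<x = ≤∧≢⇒< a≤x λ { refl → a∉ x∈ }
    nothing-below : ¬ 0 < countBelow xs a
    nothing-below pos with countBelow>0⇒∈-below xs pos
    ... | y , y∈ , y<a = a∉ (block-closed y∈ (rel-noncrossing μ y<a a<x x<b (block-related y∈ x∈) ab))
    nothing-above : ¬ countBelow xs b < length xs
    nothing-above lt with countBelow<length⇒∈-above xs lt
    ... | z , z∈ , b≤z =
      a∉ (block-closed x∈ (rel-sym μ (rel-noncrossing μ a<x x<b b<z ab (block-related x∈ z∈))))
      where b<z = ≤∧≢⇒< b≤z λ { refl → b∉ z∈ }

  gapIndex-respects-block : ∀ {a b} → a ∉ xs → b ∉ xs → rel μ a b → gapIndex xs a ≡ gapIndex xs b
  gapIndex-respects-block {a} {b} a∉ b∉ ab with <-cmp a b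
  ... | tri< a<b _ _  = gapIndex-≡ xs (related-outside-block a<b a∉ b∉ ab)
  ... | tri≈ _ refl _ = refl
  ... | tri> _ _ b<a  = sym (gapIndex-≡ xs (related-outside-block b<a b∉ a∉ (rel-sym μ ab)))

finestWithBlock : (S : ℕ → Set) → List ℕ → NCP S
finestWithBlock S xs = inducedNCP S {SameOrIn} isEquivalence noncrossing
  where
  SameOrIn : ℕ → ℕ → Set
  SameOrIn x y = x ≡ y ⊎ (x ∈ xs × y ∈ xs)
  isEquivalence : IsEquivalence SameOrIn
  isEquivalence = record
    { refl  = inj₁ refl
    ; sym   = λ { (inj₁ refl) → inj₁ refl ; (inj₂ (x∈ , y∈)) → inj₂ (y∈ , x∈) }
    ; trans = λ { (inj₁ refl) yz → yz ; xy (inj₁ refl) → xy ; (inj₂ (x∈ , _)) (inj₂ (_ , z∈)) → inj₂ (x∈ , z∈) }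
    }
  noncrossing : NonCrossingRel SameOrIn
  noncrossing a<b b<c c<d (inj₁ refl)     _               = contradiction a<b (<-asym b<c)
  noncrossing a<b b<c c<d (inj₂ _)        (inj₁ refl)     = contradiction b<c (<-asym c<d)
  noncrossing a<b b<c c<d (inj₂ (a∈ , _)) (inj₂ (b∈ , _)) = inj₂ (a∈ , b∈)

finestWithBlock-≤ : ∀ {S} (μ : NCP S) {xs} → IsBlock μ xs → finestWithBlock S xs ≤P μ
finestWithBlock-≤ μ block (sx , _ , inj₁ refl)     = rel-refl μ sx
finestWithBlock-≤ μ block (_ , _ , inj₂ (x∈ , y∈)) = block-related μ block x∈ y∈

coarsestWithBlock : (S : ℕ → Set) → List ℕ → NCP S
coarsestWithBlock S xs = inducedNCP S {InOrSameGap} isEquivalence noncrossing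
  where
  InOrSameGap : ℕ → ℕ → Set
  InOrSameGap x y = (x ∈ xs × y ∈ xs) ⊎ (x ∉ xs × y ∉ xs × gapIndex xs x ≡ gapIndex xs y)
  isEquivalence : IsEquivalence InOrSameGap
  isEquivalence = record
    { refl  = λ {x} → case x ∈? xs of λ { (yes x∈) → inj₁ (x∈ , x∈) ; (no x∉) → inj₂ (x∉ , x∉ , refl) }
    ; sym   = λ { (inj₁ (x∈ , y∈)) → inj₁ (y∈ , x∈) ; (inj₂ (x∉ , y∉ , e)) → inj₂ (y∉ , x∉ , sym e) }
    ; trans = λ { (inj₁ (x∈ , _)) (inj₁ (_ , z∈)) → inj₁ (x∈ , z∈)
                ; (inj₁ (_ , y∈)) (inj₂ (y∉ , _)) → contradiction y∈ y∉
                ; (inj₂ (_ , y∉ , _)) (inj₁ (y∈ , _)) → contradiction y∈ y∉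
                ; (inj₂ (x∉ , _ , e)) (inj₂ (_ , z∉ , e')) → inj₂ (x∉ , z∉ , trans e e') }
    }
  noncrossing : NonCrossingRel InOrSameGap
  noncrossing a<b b<c c<d (inj₁ (a∈ , _)) (inj₁ (b∈ , _)) = inj₁ (a∈ , b∈)
  noncrossing a<b b<c c<d (inj₁ (a∈ , c∈)) (inj₂ (_ , _ , bd)) =
    contradiction bd (gapIndex≢-interleavedˡ xs a<b b<c c<d a∈ c∈)
  noncrossing a<b b<c c<d (inj₂ (_ , _ , ac)) (inj₁ (b∈ , d∈)) =
    contradiction ac (gapIndex≢-interleavedʳ xs a<b b<c c<d b∈ d∈)
  noncrossing a<b b<c c<d (inj₂ (a∉ , _ , ac)) (inj₂ (b∉ , _ , bd)) =
    inj₂ (a∉ , b∉ , gapIndex-noncrossing xs a<b b<c c<d ac bd)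

≤-coarsestWithBlock : ∀ {S} (μ : NCP S) {xs} → IsBlock μ xs → μ ≤P coarsestWithBlock S xs
≤-coarsestWithBlock μ {xs} block {x} {y} xy with rel-support μ xy | x ∈? xs | y ∈? xs
... | sx , sy | yes x∈ | _      = sx , sy , inj₁ (x∈ , block-closed μ block x∈ xy)
... | sx , sy | no x∉  | yes y∈ = contradiction (block-closed μ block y∈ (rel-sym μ xy)) x∉
... | sx , sy | no x∉  | no y∉  = sx , sy , inj₂ (x∉ , y∉ , gapIndex-respects-block μ block x∉ y∉ xy)

coarsestWithBlock-closed : ∀ {S xs x y} → x ∈ xs → rel (coarsestWithBlock S xs) x y → y ∈ xs
coarsestWithBlock-closed x∈ (_ , _ , inj₁ (_ , y∈))     = y∈
coarsestWithBlock-closed x∈ (_ , _ , inj₂ (x∉ , _ , _)) = contradiction x∈ x∉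

meet-preserves-block : ∀ {S} (μ ν ρ : NCP S) {xs} →
                       IsBlock μ xs → IsBlock ν xs → IsMeet μ ν ρ → IsBlock ρ xs
meet-preserves-block {S} μ ν ρ {xs} μ-block ν-block (ρ≤μ , _ , greatest) x y x∈ = mk⇔
  (block-closed μ μ-block x∈ ∘ ρ≤μ)
  (λ y∈ → greatest (finestWithBlock S xs) (finestWithBlock-≤ μ μ-block) (finestWithBlock-≤ ν ν-block)
                   (block⊆support μ μ-block x∈ , block⊆support μ μ-block y∈ , inj₂ (x∈ , y∈)))

join-preserves-block : ∀ {S} (μ ν ρ : NCP S) {xs} →
                       IsBlock μ xs → IsBlock ν xs → IsJoin μ ν ρ → IsBlock ρ xs
join-preserves-block {S} μ ν ρ {xs} μ-block ν-block (μ≤ρ , _ , least) x y x∈ = mk⇔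
  (coarsestWithBlock-closed x∈ ∘
     least (coarsestWithBlock S xs) (≤-coarsestWithBlock μ μ-block) (≤-coarsestWithBlock ν ν-block))
  (μ≤ρ ∘ block-related μ μ-block x∈)

hasBlocks-isSublattice : ∀ n k π → IsSublattice n k π
hasBlocks-isSublattice n k π =
    (λ μ ν ρ μ-blocks ν-blocks meet i → meet-preserves-block μ ν ρ (μ-blocks i) (ν-blocks i) meet)
  , (λ μ ν ρ μ-blocks ν-blocks join i → join-preserves-block μ ν ρ (μ-blocks i) (ν-blocks i) join)

-- The regions μ₀ and μᵢʲ

_≺?_ : (B C : List⁺ ℕ) → Dec (B ≺ C)
B ≺? C = (head C <? head B) ×-dec (head B ≤? last B) ×-dec (last B <? last C)

maximiser : ∀ {k} {P : Fin k → Set} → Decidable P → (f : Fin k → ℕ) →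
            ∃ P → ∃ λ i → P i × (∀ j → P j → f j ≤ f i)
maximiser {k} P? f (i₀ , pi₀) =
  best , argmax-all f pi₀ (all-filter P? (allFin k)) ,
  λ j pj → All.lookup (f[xs]≤f[argmax] i₀ _) (∈-filter⁺ P? (∈-allFin j) pj)
  where best = argmax f i₀ (filter P? (allFin k))

suc-toℕ-onto : ∀ {m c} → 0 < c → c < suc m → ∃ λ (j : Fin m) → c ≡ suc (toℕ j)
suc-toℕ-onto {c = suc c} _ c<m = F.fromℕ< (≤-pred c<m) , cong suc (sym (toℕ-fromℕ< (≤-pred c<m)))

module PrescribedBlocks (n k : ℕ) (π : Fin k → List⁺ ℕ)
  (sorted : ∀ i → Linked _<_ (toList (π i)))
  (⊆[n] : ∀ i x → x ∈ toList (π i) → InN n x)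
  (disjoint : ∀ i i' → i ≢ i' → ∀ x → x ∈ toList (π i) → x ∉ toList (π i'))
  (noncrossing : NonCrossingRel (πmin n k π))
  where

  P : Fin k → List ℕ
  P i = toList (π i)

  Outside : ℕ → Set
  Outside x = ∀ i → x ∉ P i

  same-block : ∀ {i i' x} → x ∈ P i → x ∈ P i' → i ≡ i'
  same-block {i} {i'} x∈ x∈' with i F.≟ i'
  ... | yes i≡i' = i≡i'
  ... | no  i≢i' = contradiction x∈' (disjoint i i' i≢i' _ x∈)

  interleaved⇒same-block : ∀ {i i' a b c d} → a < b → b < c → c < d →
                           a ∈ P i → c ∈ P i → b ∈ P i' → d ∈ P i' → i ≡ i'
  interleaved⇒same-block a<b b<c c<d a∈ c∈ b∈ d∈
    with noncrossing a<b b<c c<d (inj₂ (_ , a∈ , c∈)) (inj₂ (_ , b∈ , d∈))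
  ... | inj₁ (a≡b , _)       = contradiction a≡b (<⇒≢ a<b)
  ... | inj₂ (_ , a∈' , b∈') = trans (same-block a∈ a∈') (same-block b∈' b∈)

  meets-interval⇒inside : ∀ {i i' a c y} → i' ≢ i → a ∈ P i → c ∈ P i → y ∈ P i' → a < y → y < c →
                          ∀ {z} → z ∈ P i' → a < z × z < c
  meets-interval⇒inside {i} {i'} {a} {c} {y} i'≢i a∈ c∈ y∈ a<y y<c {z} z∈ = above-a , below-c
    where
    above-a : a < z
    above-a with <-cmp z a
    ... | tri< z<a _ _  = contradiction (interleaved⇒same-block z<a a<y y<c z∈ y∈ a∈ c∈) i'≢i
    ... | tri≈ _ refl _ = contradiction (same-block z∈ a∈) i'≢i
    ... | tri> _ _ a<z  = a<z
    below-c : z < c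
    below-c with <-cmp z c
    ... | tri< z<c _ _  = z<c
    ... | tri≈ _ refl _ = contradiction (same-block z∈ c∈) i'≢i
    ... | tri> _ _ c<z  = contradiction (sym (interleaved⇒same-block a<y y<c c<z a∈ c∈ y∈ z∈)) i'≢i

  meets-interval⇒≺ : ∀ {i i' a c y} → i' ≢ i → a ∈ P i → c ∈ P i → y ∈ P i' → a < y → y < c → π i' ≺ π i
  meets-interval⇒≺ {i} {i'} i'≢i a∈ c∈ y∈ a<y y<c =
      ≤-<-trans (head≤ (sorted i) a∈) (proj₁ (inside (here refl)))
    , head≤ (sorted i') (last-∈ (π i'))
    , <-≤-trans (proj₂ (inside (last-∈ (π i')))) (≤last (π i) (sorted i) c∈)
    where inside = meets-interval⇒inside i'≢i a∈ c∈ y∈ a<y y<c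

  nested-comparable : ∀ {i i' x} → i ≢ i' → [ x ] ≺ π i → [ x ] ≺ π i' → π i ≺ π i' ⊎ π i' ≺ π i
  nested-comparable {i} {i'} i≢i' (h<x , _ , x<l) (h'<x , _ , x<l') with <-cmp (head (π i)) (head (π i'))
  ... | tri< h<h' _ _ =
    inj₂ (meets-interval⇒≺ (i≢i' ∘ sym) (here refl) (last-∈ (π i)) (here refl) h<h' (<-trans h'<x x<l))
  ... | tri≈ _ h≡h' _ =
    contradiction (same-block (here refl) (subst (_∈ P i') (sym h≡h') (here refl))) i≢i'
  ... | tri> _ _ h'<h =
    inj₁ (meets-interval⇒≺ i≢i' (here refl) (last-∈ (π i')) (here refl) h'<h (<-trans h<x x<l'))

  unnested⇒gapIndex≡0 : ∀ {i x} → x ∉ P i → ¬ [ x ] ≺ π i → gapIndex (P i) x ≡ 0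
  unnested⇒gapIndex≡0 {i} {x} x∉ unnested with x <? head (π i) | last (π i) <? x
  ... | yes x<h | _       =
    trans (cong (wrapAt _) (countBelow≡0 (P i) λ y∈ → <⇒≤ (<-≤-trans x<h (head≤ (sorted i) y∈))))
          (wrapAt-zero (length (P i)))
  ... | no _    | yes l<x =
    trans (cong (wrapAt _) (countBelow≡length (P i) λ y∈ → ≤-<-trans (≤last (π i) (sorted i) y∈) l<x))
          (wrapAt-self (length (P i)))
  ... | no x≮h  | no l≮x  = contradiction
    (≤∧≢⇒< (≮⇒≥ x≮h) (λ { refl → x∉ (here refl) }) , ≤-refl , ≤∧≢⇒< (≮⇒≥ l≮x) (λ { refl → x∉ (last-∈ (π i)) }))
    unnested

  nested⇒countBelow-inner : ∀ {i x} → [ x ] ≺ π i →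
                            0 < countBelow (P i) x × countBelow (P i) x < length (P i)
  nested⇒countBelow-inner {i} (h<x , _ , x<l) =
      ≤-<-trans z≤n (countBelow-strict (P i) (here refl) z≤n h<x)
    , countBelow<length (P i) (last-∈ (π i)) (<⇒≤ x<l)

  nested⇒gapIndex≢0 : ∀ {i x} → [ x ] ≺ π i → gapIndex (P i) x ≢ 0
  nested⇒gapIndex≢0 nested gap≡0 with nested⇒countBelow-inner nested
  ... | 0<c , c<len = <⇒≢ 0<c (sym (trans (sym (wrapAt-< c<len)) gap≡0))

  gapIndex≢0⇒nested : ∀ {i x} → x ∉ P i → gapIndex (P i) x ≢ 0 → [ x ] ≺ π i
  gapIndex≢0⇒nested {i} {x} x∉ gap≢0 = decidable-stable ([ x ] ≺? π i) (gap≢0 ∘ unnested⇒gapIndex≡0 x∉)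

  μ₀⇒gapIndex≡0 : ∀ {x} → μ₀ n k π x → ∀ i → gapIndex (P i) x ≡ 0
  μ₀⇒gapIndex≡0 (_ , outside , unnested) i = unnested⇒gapIndex≡0 (outside i) (unnested i)

  μgap⇒gapIndex : ∀ {i j x} → μgap k π (i , j) x → gapIndex (P i) x ≡ suc (toℕ j)
  μgap⇒gapIndex {i} {j} (lo , hi , outside , _) =
    trans (cong (wrapAt _) c≡) (wrapAt-< (s≤s (toℕ<n j)))
    where c≡ = Equivalence.to (between⇔countBelow≡ (sorted i) (outside i) j) (lo , hi)

  μgap⇒nested : ∀ {i j x} → μgap k π (i , j) x → [ x ] ≺ π i
  μgap⇒nested {i} {j} (lo , hi , _) =
      ≤-<-trans (head≤ (sorted i) (∈-lookup {xs = P i} (inject₁ j))) lo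
    , ≤-refl
    , <-≤-trans hi (≤last (π i) (sorted i) (∈-lookup {xs = P i} (F.suc j)))

  SameGaps : ℕ → ℕ → Set
  SameGaps x y = ∀ i → gapIndex (P i) x ≡ gapIndex (P i) y

  μgap-sameGaps : ∀ {g x y} → μgap k π g x → μgap k π g y → SameGaps x y
  μgap-sameGaps {i , j} x∈@(x-lo , x-hi , x-out , x-unnested) y∈@(y-lo , y-hi , y-out , y-unnested) i'
    with i' F.≟ i
  ... | yes refl = trans (μgap⇒gapIndex x∈) (sym (μgap⇒gapIndex y∈))
  ... | no i'≢i with π i' ≺? π i
  ...   | yes i'≺i = trans (unnested⇒gapIndex≡0 (x-out i') (x-unnested i' i'≺i))
                           (sym (unnested⇒gapIndex≡0 (y-out i') (y-unnested i' i'≺i)))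
  ...   | no i'⊀i  = cong (wrapAt _) (countBelow-constant (P i') avoids x-lo x-hi y-lo y-hi)
    where
    avoids : ∀ {z} → z ∈ P i' → lookup (P i) (inject₁ j) < z → z < lookup (P i) (F.suc j) → ⊥
    avoids z∈ = i'⊀i ∘₂ meets-interval⇒≺ i'≢i (∈-lookup (inject₁ j)) (∈-lookup (F.suc j)) z∈

  μgap-sameGaps⇒nested : ∀ {i j i' j' x y} → μgap k π (i , j) x → μgap k π (i' , j') y →
                         SameGaps x y → [ x ] ≺ π i'
  μgap-sameGaps⇒nested {i' = i'} (_ , _ , x-out , _) y∈ same =
    gapIndex≢0⇒nested (x-out i') λ gap≡0 → 0≢1+n (trans (sym gap≡0) (trans (same i') (μgap⇒gapIndex y∈)))

  μgap-distinct : ∀ {i j i' j' x y} → i ≢ i' → μgap k π (i , j) x → μgap k π (i' , j') y → ¬ SameGaps x y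
  μgap-distinct {i} {i' = i'} i≢i' x∈@(_ , _ , _ , x-unnested) y∈@(_ , _ , _ , y-unnested) same =
    [ (λ i≺i' → y-unnested i i≺i' (μgap-sameGaps⇒nested y∈ x∈ (sym ∘ same)))
    , (λ i'≺i → x-unnested i' i'≺i (μgap-sameGaps⇒nested x∈ y∈ same))
    ]′ (nested-comparable i≢i' (μgap⇒nested x∈) (μgap-sameGaps⇒nested x∈ y∈ same))

  μgap-unique : ∀ {i j i' j' x y} → μgap k π (i , j) x → μgap k π (i' , j') y → SameGaps x y →
                _≡_ {A = Gap k π} (i , j) (i' , j')
  μgap-unique {i} {j} {i'} {j'} {x} {y} x∈ y∈ same with i F.≟ i'
  ... | no  i≢i' = contradiction same (μgap-distinct i≢i' x∈ y∈)
  ... | yes refl = cong (i ,_) (toℕ-injective (suc-injective (begin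
    suc (toℕ j)      ≡⟨ μgap⇒gapIndex x∈ ⟨
    gapIndex (P i) x ≡⟨ same i ⟩
    gapIndex (P i) y ≡⟨ μgap⇒gapIndex y∈ ⟩
    suc (toℕ j')     ∎)))
    where open ≡-Reasoning

  Region : Set
  Region = Maybe (Gap k π)

  InRegion : Region → ℕ → Set
  InRegion nothing  = μ₀ n k π
  InRegion (just g) = μgap k π g

  region⇒outside : ∀ r {x} → InRegion r x → Outside x
  region⇒outside nothing  (_ , outside , _)     = outside
  region⇒outside (just _) (_ , _ , outside , _) = outside

  region⇒InN : ∀ r {x} → InRegion r x → InN n x
  region⇒InN nothing        (x∈[n] , _)   = x∈[n]
  region⇒InN (just (i , j)) (lo , hi , _) =
      ≤-trans (proj₁ (⊆[n] i _ (∈-lookup (inject₁ j)))) (<⇒≤ lo)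
    , ≤-trans (<⇒≤ hi) (proj₂ (⊆[n] i _ (∈-lookup (F.suc j))))

  region-sameGaps : ∀ r {x y} → InRegion r x → InRegion r y → SameGaps x y
  region-sameGaps nothing  x∈ y∈ i = trans (μ₀⇒gapIndex≡0 x∈ i) (sym (μ₀⇒gapIndex≡0 y∈ i))
  region-sameGaps (just _) x∈ y∈   = μgap-sameGaps x∈ y∈

  region-unique : ∀ r r' {x y} → InRegion r x → InRegion r' y → SameGaps x y → r ≡ r'
  region-unique nothing        nothing        _  _  _    = refl
  region-unique nothing        (just (i , _)) x∈ y∈ same =
    contradiction (trans (sym (μ₀⇒gapIndex≡0 x∈ i)) (trans (same i) (μgap⇒gapIndex y∈))) 0≢1+n
  region-unique (just (i , _)) nothing        x∈ y∈ same =
    contradiction (trans (sym (μ₀⇒gapIndex≡0 y∈ i)) (trans (sym (same i)) (μgap⇒gapIndex x∈))) 0≢1+n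
  region-unique (just _)       (just _)       x∈ y∈ same = cong just (μgap-unique x∈ y∈ same)

  region-closed : ∀ r {x y} → InRegion r x → InN n y → Outside y → SameGaps x y → InRegion r y
  region-closed nothing x∈ y∈[n] y-out same =
    y∈[n] , y-out , λ i nested → nested⇒gapIndex≢0 nested (trans (sym (same i)) (μ₀⇒gapIndex≡0 x∈ i))
  region-closed (just (i , j)) x∈@(_ , _ , x-out , x-unnested) _ y-out same =
    let (lo , hi) = Equivalence.from (between⇔countBelow≡ (sorted i) (y-out i) j)
                                     (wrapAt≡suc (trans (sym (same i)) (μgap⇒gapIndex x∈)))
    in lo , hi , y-out , λ i' i'≺i nested → nested⇒gapIndex≢0 nested
                           (trans (sym (same i')) (unnested⇒gapIndex≡0 (x-out i') (x-unnested i' i'≺i)))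

  innermost⇒μgap : ∀ {i x} → Outside x → [ x ] ≺ π i → (∀ i' → [ x ] ≺ π i' → head (π i') ≤ head (π i)) →
                   ∃ λ j → μgap k π (i , j) x
  innermost⇒μgap {i} x-out nested innermost =
    let (0<c , c<len) = nested⇒countBelow-inner nested
        (j , c≡)      = suc-toℕ-onto 0<c c<len
        (lo , hi)     = Equivalence.from (between⇔countBelow≡ (sorted i) (x-out i) j) c≡
    in j , lo , hi , x-out , λ i' i'≺i nested' → <⇒≱ (proj₁ i'≺i) (innermost i' nested')

  classify : ∀ {x} → InN n x → Outside x → ∃ λ r → InRegion r x
  classify {x} x∈[n] x-out with any? (λ i → [ x ] ≺? π i)
  ... | no unnested = nothing , x∈[n] , x-out , λ i nested → unnested (i , nested)
  ... | yes some with maximiser (λ i → [ x ] ≺? π i) (head ∘ π) some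
  ...   | i , nested , innermost =
    let (j , x∈) = innermost⇒μgap x-out nested innermost in just (i , j) , x∈

  block-or-outside : ∀ x → (∃ λ i → x ∈ P i) ⊎ Outside x
  block-or-outside x with any? (λ i → x ∈? P i)
  ... | yes found = inj₁ found
  ... | no  none  = inj₂ λ i x∈ → none (i , x∈)

  -- Restriction to the regions, and gluing

  module _ (μ : NCP (InN n)) (blocks : HasBlocks k π μ) where

    related-outside : ∀ {x y} → rel μ x y → Outside x → Outside y
    related-outside xy x-out i y∈ = x-out i (block-closed μ (blocks i) y∈ (rel-sym μ xy))

    related-same-region : ∀ r {x y} → rel μ x y → InRegion r x → InRegion r y
    related-same-region r xy x∈ = region-closed r x∈ (proj₂ (rel-support μ xy)) y-out
      λ i → gapIndex-respects-block μ (blocks i) (x-out i) (y-out i) xy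
      where
      x-out = region⇒outside r x∈
      y-out = related-outside xy x-out

  regionsOf : NCP (InN n) → Prod n k π
  regionsOf μ = restrictTo nothing , restrictTo ∘ just
    where
    restrictTo : (r : Region) → NCP (InRegion r)
    restrictTo r = restrict (region⇒InN r) μ

  regionsOf-reflects-≤ : ∀ μ ν → regionsOf μ ≤Prod regionsOf ν →
                         ∀ r {x y} → InRegion r x → InRegion r y → rel μ x y → rel ν x y
  regionsOf-reflects-≤ _ _ (≤₀ , _) nothing  x∈ y∈ xy = proj₁ (≤₀ (xy , x∈ , y∈))
  regionsOf-reflects-≤ _ _ (_ , ≤ᵍ) (just g) x∈ y∈ xy = proj₁ (≤ᵍ g (xy , x∈ , y∈))

  regionsOf-≤⇔ : (a b : NCPπ n k π) → proj₁ a ≤P proj₁ b ⇔ regionsOf (proj₁ a) ≤Prod regionsOf (proj₁ b)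
  regionsOf-≤⇔ (μ , μ-blocks) (ν , ν-blocks) = mk⇔ preserves reflects
    where
    preserves : μ ≤P ν → regionsOf μ ≤Prod regionsOf ν
    preserves μ≤ν = (λ (xy , x∈ , y∈) → μ≤ν xy , x∈ , y∈) , (λ _ (xy , x∈ , y∈) → μ≤ν xy , x∈ , y∈)
    reflects : regionsOf μ ≤Prod regionsOf ν → μ ≤P ν
    reflects regions≤ {x} xy with block-or-outside x
    ... | inj₁ (i , x∈) = block-related ν (ν-blocks i) x∈ (block-closed μ (μ-blocks i) x∈ xy)
    ... | inj₂ x-out with classify (proj₁ (rel-support μ xy)) x-out
    ...   | r , x∈ = regionsOf-reflects-≤ μ ν regions≤ r x∈ (related-same-region μ μ-blocks r xy x∈) xy

  component : Prod n k π → (r : Region) → NCP (InRegion r)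
  component (A , _) nothing  = A
  component (_ , f) (just g) = f g

  module Glue (p : Prod n k π) where

    Glued : ℕ → ℕ → Set
    Glued x y = (∃ λ i → x ∈ P i × y ∈ P i) ⊎ (∃ λ r → rel (component p r) x y)

    in-region : ∀ r {x y} → rel (component p r) x y → InRegion r x × InRegion r y
    in-region r = rel-support (component p r)

    component-sameGaps : ∀ r {x y} → rel (component p r) x y → SameGaps x y
    component-sameGaps r xy = region-sameGaps r (proj₁ (in-region r xy)) (proj₂ (in-region r xy))

    transport : ∀ {r r' x y} → r ≡ r' → rel (component p r) x y → rel (component p r') x y
    transport {x = x} {y} = subst (λ r → rel (component p r) x y)

    move-block : ∀ {i i' x y} → x ∈ P i → x ∈ P i' → y ∈ P i' → y ∈ P i
    move-block {y = y} x∈ x∈' = subst (λ i → y ∈ P i) (sym (same-block x∈ x∈'))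

    support : ∀ {x y} → Glued x y → InN n x × InN n y
    support (inj₁ (i , x∈ , y∈)) = ⊆[n] i _ x∈ , ⊆[n] i _ y∈
    support (inj₂ (r , xy))      = let (x∈ , y∈) = in-region r xy in region⇒InN r x∈ , region⇒InN r y∈

    reflexive : ∀ {x} → InN n x → Glued x x
    reflexive {x} x∈[n] with block-or-outside x
    ... | inj₁ (i , x∈) = inj₁ (i , x∈ , x∈)
    ... | inj₂ x-out    = let (r , x∈) = classify x∈[n] x-out in inj₂ (r , rel-refl (component p r) x∈)

    symmetric : ∀ {x y} → Glued x y → Glued y x
    symmetric (inj₁ (i , x∈ , y∈)) = inj₁ (i , y∈ , x∈)
    symmetric (inj₂ (r , xy))      = inj₂ (r , rel-sym (component p r) xy)

    transitive : ∀ {x y z} → Glued x y → Glued y z → Glued x z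
    transitive (inj₁ (i , x∈ , y∈)) (inj₁ (_ , y∈' , z∈)) = inj₁ (i , x∈ , move-block y∈ y∈' z∈)
    transitive (inj₁ (i , _ , y∈))  (inj₂ (r , yz))       =
      contradiction y∈ (region⇒outside r (proj₁ (in-region r yz)) i)
    transitive (inj₂ (r , xy))      (inj₁ (i , y∈ , _))   =
      contradiction y∈ (region⇒outside r (proj₂ (in-region r xy)) i)
    transitive (inj₂ (r , xy))      (inj₂ (r' , yz))      = inj₂ (r' , rel-trans (component p r') (transport r≡r' xy) yz)
      where r≡r' = region-unique r r' (proj₂ (in-region r xy)) (proj₁ (in-region r' yz)) λ _ → refl

    glued-noncrossing : NonCrossingRel Glued
    glued-noncrossing a<b b<c c<d (inj₁ (i , a∈ , c∈)) (inj₁ (_ , b∈ , d∈)) =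
      inj₁ (i , a∈ , subst (λ i → _ ∈ P i) (sym (interleaved⇒same-block a<b b<c c<d a∈ c∈ b∈ d∈)) b∈)
    glued-noncrossing a<b b<c c<d (inj₁ (i , a∈ , c∈)) (inj₂ (r , bd)) =
      contradiction (component-sameGaps r bd i) (gapIndex≢-interleavedˡ (P i) a<b b<c c<d a∈ c∈)
    glued-noncrossing a<b b<c c<d (inj₂ (r , ac)) (inj₁ (i , b∈ , d∈)) =
      contradiction (component-sameGaps r ac i) (gapIndex≢-interleavedʳ (P i) a<b b<c c<d b∈ d∈)
    glued-noncrossing {a} {b} a<b b<c c<d (inj₂ (r , ac)) (inj₂ (r' , bd)) =
      inj₂ (r , rel-noncrossing (component p r) a<b b<c c<d ac (transport (sym r≡r') bd))
      where
      same : SameGaps a b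
      same i = gapIndex-noncrossing (P i) a<b b<c c<d (component-sameGaps r ac i) (component-sameGaps r' bd i)
      r≡r' : r ≡ r'
      r≡r' = region-unique r r' (proj₁ (in-region r ac)) (proj₁ (in-region r' bd)) same

    glued : NCP (InN n)
    glued = record
      { _~_ = Glued ; support = support ; ~-refl = reflexive ; ~-sym = symmetric ; ~-trans = transitive }
      , glued-noncrossing

    glued-blocks : HasBlocks k π glued
    glued-blocks i x y x∈ = mk⇔ closed (λ y∈ → inj₁ (i , x∈ , y∈))
      where
      closed : Glued x y → y ∈ P i
      closed (inj₁ (_ , x∈' , y∈)) = move-block x∈ x∈' y∈
      closed (inj₂ (r , xy))       = contradiction x∈ (region⇒outside r (proj₁ (in-region r xy)) i)

    glued⇒component : ∀ r {x y} → Glued x y → InRegion r x → rel (component p r) x y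
    glued⇒component r (inj₁ (i , x∈ , _)) x∈r = contradiction x∈ (region⇒outside r x∈r i)
    glued⇒component r (inj₂ (r' , xy))   x∈r =
      transport (region-unique r' r (proj₁ (in-region r' xy)) x∈r λ _ → refl) xy

    regionsOf-glued : regionsOf glued ≈Prod p
    regionsOf-glued =
        ( (λ (xy , x∈ , _) → glued⇒component nothing xy x∈)
        , (λ g (xy , x∈ , _) → glued⇒component (just g) xy x∈) )
      , ( (λ xy → inj₂ (nothing , xy) , in-region nothing xy)
        , (λ g xy → inj₂ (just g , xy) , in-region (just g) xy) )

  latticeIso : LatticeIso n k π
  latticeIso = regionsOf ∘ proj₁ , regionsOf-≤⇔ , λ p → (Glue.glued p , Glue.glued-blocks p) , Glue.regionsOf-glued p

lemma3p1 : (n k : ℕ) (π : Fin k → List⁺ ℕ)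
    → (∀ i → Linked _<_ (toList (π i)))
    → (∀ i x → x ∈ toList (π i) → InN n x)
    → (∀ i i' → i ≢ i' → ∀ x → x ∈ toList (π i) → x ∉ toList (π i'))
    → NonCrossingRel (πmin n k π)
    → IsSublattice n k π × LatticeIso n k π
lemma3p1 n k π sorted ⊆[n] disjoint noncrossing =
  hasBlocks-isSublattice n k π , PrescribedBlocks.latticeIso n k π sorted ⊆[n] disjoint noncrossing
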